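{- Let $G$ be a directed graph. The collection of arc sets of all directed spanning trees of $G$ satisfies the weak exchange property: for any two directed spanning trees $T \neq T'$ of $G$, there exist arcs $e\in A(T)\setminus A(T')$ and $e'\in A(T')\setminus A(T)$ such that $(A(T)\setminus\{e\})\cup\{e'\}$ is the arc set of a directed spanning tree of $G$.
   Context: A directed tree is a directed graph whose underlying undirected graph is a tree and in which every vertex except one vertex $r$ (the root) has in-degree exactly $1$. A directed spanning tree of $G$ is a subgraph of $G$ that is a directed tree containing all vertices of $G$. -}

module Defs where

open import Data.Nat using (ℕ)
open import Data.Fin using (Fin; _≟_)
open import Data.Fin.Subset using (Subset; _∈_)
open import Data.Fin.Subset.Properties using (_∈?_)
open import Data.List using (List; []; _∷_; filter; length)
open import Data.List.Relation.Unary.Unique.Propositional using (Unique)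
open import Data.Product using (Σ; ∃; _×_; _,_)
open import Relation.Binary.PropositionalEquality using (_≡_; _≢_)
open import Relation.Nullary using (¬_)
open import Relation.Nullary.Decidable using (_×-dec_)

-- A finite directed graph (loops and parallel arcs allowed):
-- vertices Fin n, arcs Fin m, each arc a goes from tail a to head a.
record DiGraph : Set where
  field
    n    : ℕ
    m    : ℕ
    tail : Fin m → Fin n
    head : Fin m → Fin n

module _ (G : DiGraph) where
  open DiGraph G

  -- Walks in the underlying undirected graph of the spanning subgraph
  -- with arc set S, from u to v, traversing the listed arcs in order
  -- (each arc may be traversed forwards or backwards).
  data UWalk (S : Subset m) : Fin n → Fin n → List (Fin m) → Set where
    nil : ∀ {u} → UWalk S u u []
    fwd : ∀ {u v e es} → e ∈ S → tail e ≡ u → UWalk S (head e) v es → UWalk S u v (e ∷ es)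
    bwd : ∀ {u v e es} → e ∈ S → head e ≡ u → UWalk S (tail e) v es → UWalk S u v (e ∷ es)

  Connected : Subset m → Set
  Connected S = ∀ u v → ∃ λ es → UWalk S u v es

  -- underlying undirected graph has no cycle: every closed walk with
  -- pairwise distinct arcs (closed trail) is empty
  Acyclic : Subset m → Set
  Acyclic S = ∀ u es → UWalk S u u es → Unique es → es ≡ []

  IsUndirectedTree : Subset m → Set
  IsUndirectedTree S = Connected S × Acyclic S

  inDegree : Subset m → Fin n → ℕ
  inDegree S v = length (filter (λ e → (e ∈? S) ×-dec (head e ≟ v)) (Data.List.allFin m))

  IsDirectedSpanningTree : Subset m → Set
  IsDirectedSpanningTree S =
    IsUndirectedTree S × (Σ (Fin n) λ r → ∀ v → v ≢ r → inDegree S v ≡ 1)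

{-# OPTIONS --safe #-}
-- In a directed spanning tree the root has no in-arc (an acyclic graph cannot enter every vertex)
-- and every other vertex has exactly one.  Replacing an arc e of T by e′ keeps an undirected tree
-- whenever the ends of e′ lie in different components of T - e, and changes in-degrees only at
-- head e and head e′.  Let r, r′ be the roots of T, T′.
-- If r ≢ r′, let e′ be the T′-arc entering r.  The T-trail from r to tail e′ cannot lie in T′
-- (it would close a cycle with e′), so it contains an arc e ∉ T′; T - e separates the ends of
-- e′, and the exchanged tree is rooted at head e.
-- If r ≡ r′, the directed T′-path from r to an arc of T′ outside T leaves T at a first arc e′,
-- whose tail is reached from r inside T ∩ T′.  Let e be the T-arc entering head e′; then e ∉ T′.
-- Every trail from the root is a directed path, so in T - e the root does not reach head e′;
-- hence T - e separates the ends of e′, and the exchanged tree is still rooted at r.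
module Submission where

open import Defs
open import Data.Empty using (⊥; ⊥-elim)
open import Data.Fin using (Fin; _≟_)
open import Data.Fin.Properties using (¬∀⟶∃¬)
open import Data.Fin.Subset
  using (Subset; _∈_; _∉_; _∪_; _∩_; _─_; _-_; ⁅_⁆; _⊆_; ⊤; ∣_∣; inside; outside)
open import Data.Fin.Subset.Properties
  using (_∈?_; x∈p∪q⁻; x∈p∪q⁺; x∈⁅x⁆; x∈⁅y⁆⇒x≡y; x∉⁅y⁆⇒x≢y; x∈p∩q⁺; x∈p∩q⁻;
         x∈p∧x≢y⇒x∈p-y; p─q⊆p; ∣p∣≤n; x∈p⇒∣p-x∣<∣p∣; ∈⊤; ⊆-antisym)
open import Data.List using ([]; _∷_; _++_; length; filter; allFin)
open import Data.List.Membership.Propositional using (find) renaming (_∈_ to _∈ˡ_; _∉_ to _∉ˡ_)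
open import Data.List.Membership.Propositional.Properties using (∈-filter⁺; ∈-filter⁻; ∈-allFin)
open import Data.List.Relation.Unary.All as All using (All; []; _∷_; all?)
open import Data.List.Relation.Unary.All.Properties as Allₚ using (¬Any⇒All¬; ¬All⇒Any¬)
open import Data.List.Relation.Unary.Any using (here; there)
open import Data.List.Relation.Unary.AllPairs using ([]; _∷_)
open import Data.List.Relation.Unary.Unique.Propositional using (Unique)
open import Data.List.Relation.Unary.Unique.Propositional.Properties
  using (filter⁺; allFin⁺; Unique[x∷xs]⇒x∉xs)
open import Data.Nat using (suc; _<_; s≤s)
open import Data.Nat.Properties using (<-≤-trans)
open import Data.Product as Product using (Σ; ∃; _×_; _,_; proj₁; proj₂)
open import Data.Sum as Sum using (_⊎_; inj₁; inj₂)
open import Data.Vec using (_∷_)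
open import Data.Vec.Base using () renaming (here to hereᵛ; there to thereᵛ)
open import Relation.Binary.Construct.Closure.ReflexiveTransitive using (Star; ε; _◅_)
open import Relation.Binary.PropositionalEquality using (_≡_; _≢_; refl; sym; trans; subst)
open import Relation.Nullary using (¬_; yes; no)
open import Relation.Nullary.Decidable using (_×-dec_; _→-dec_)
open import Relation.Unary using (Decidable)
import Data.List.Membership.DecPropositional as DecMembership

module _ {A : Set} {P : A → Set} (P? : Decidable P) where

  length-filter≡1⇒ : ∀ xs → length (filter P? xs) ≡ 1
                   → ∃ λ x → P x × (∀ {y} → y ∈ˡ xs → P y → y ≡ x)
  length-filter≡1⇒ xs _ with filter P? xs in eq
  length-filter≡1⇒ xs refl | x ∷ [] = x , proj₂ (∈-filter⁻ P? {xs = xs} x∈) , unique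
    where
    x∈ : x ∈ˡ filter P? xs
    x∈ = subst (x ∈ˡ_) (sym eq) (here refl)
    unique : ∀ {y} → y ∈ˡ xs → P y → y ≡ x
    unique y∈ Py with subst (_ ∈ˡ_) eq (∈-filter⁺ P? y∈ Py)
    ... | here y≡x = y≡x

  length-filter≡1⇐ : ∀ {xs x} → Unique xs → x ∈ˡ xs → P x
                   → (∀ {y} → y ∈ˡ xs → P y → y ≡ x) → length (filter P? xs) ≡ 1
  length-filter≡1⇐ {xs} {x} xs! x∈ Px unique =
    singleton (filter⁺ P? xs!) (∈-filter⁺ P? x∈ Px) unique′
    where
    unique′ : ∀ {y} → y ∈ˡ filter P? xs → y ≡ x
    unique′ y∈ = let (y∈xs , Py) = ∈-filter⁻ P? y∈ in unique y∈xs Py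
    singleton : ∀ {ys z} → Unique ys → z ∈ˡ ys → (∀ {y} → y ∈ˡ ys → y ≡ z) → length ys ≡ 1
    singleton {_ ∷ []}    _              _ _  = refl
    singleton {a ∷ b ∷ _} ((a≢b ∷ _) ∷ _) _ eq =
      ⊥-elim (a≢b (trans (eq (here refl)) (sym (eq (there (here refl))))))

x∈p─q⇒x∉q : ∀ {n} {x : Fin n} (p q : Subset n) → x ∈ p ─ q → x ∉ q
x∈p─q⇒x∉q (inside ∷ p) (outside ∷ q) hereᵛ      ()
x∈p─q⇒x∉q (_ ∷ p)      (_ ∷ q)       (thereᵛ x∈) (thereᵛ x∈q) = x∈p─q⇒x∉q p q x∈ x∈q

x∈p-y⇒x≢y : ∀ {n} {x y : Fin n} (p : Subset n) → x ∈ p - y → x ≢ y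
x∈p-y⇒x≢y p x∈ = x∉⁅y⁆⇒x≢y (x∈p─q⇒x∉q p _ x∈)

⊈⇒∃ : ∀ {k} {p q : Subset k} → ¬ (p ⊆ q) → ∃ λ x → x ∈ p × x ∉ q
⊈⇒∃ {k} {p} {q} p⊈q
  with ¬∀⟶∃¬ k (λ x → x ∈ p → x ∈ q) (λ x → (x ∈? p) →-dec (x ∈? q)) (λ p⊆q → p⊈q (p⊆q _))
... | x , ¬[x∈p→x∈q] with x ∈? p
...   | yes x∈p = x , x∈p , λ x∈q → ¬[x∈p→x∈q] (λ _ → x∈q)
...   | no x∉p = ⊥-elim (¬[x∈p→x∈q] (λ x∈p → ⊥-elim (x∉p x∈p)))

module _ (G : DiGraph) where
  open DiGraph G
  open DecMembership (_≟_ {m}) using () renaming (_∈?_ to _∈ˡ?_)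

  Linked : Subset m → Fin n → Fin n → Set
  Linked S u v = ∃ (UWalk G S u v)

  arcs⊆ : ∀ {S u v es f} → UWalk G S u v es → f ∈ˡ es → f ∈ S
  arcs⊆ (fwd f∈ _ _) (here refl) = f∈
  arcs⊆ (bwd f∈ _ _) (here refl) = f∈
  arcs⊆ (fwd _ _ w)  (there f∈)  = arcs⊆ w f∈
  arcs⊆ (bwd _ _ w)  (there f∈)  = arcs⊆ w f∈

  relabel : ∀ {S S′ u v es} → (∀ {f} → f ∈ˡ es → f ∈ S → f ∈ S′)
          → UWalk G S u v es → UWalk G S′ u v es
  relabel h nil          = nil
  relabel h (fwd f∈ t w) = fwd (h (here refl) f∈) t (relabel (λ f∈ → h (there f∈)) w)
  relabel h (bwd f∈ t w) = bwd (h (here refl) f∈) t (relabel (λ f∈ → h (there f∈)) w)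

  walk-mono : ∀ {S S′ u v es} → S ⊆ S′ → UWalk G S u v es → UWalk G S′ u v es
  walk-mono S⊆S′ = relabel (λ _ → S⊆S′)

  walk-avoid : ∀ {S u v es f} → f ∉ˡ es → UWalk G S u v es → UWalk G (S - f) u v es
  walk-avoid f∉ = relabel (λ g∈ g∈S → x∈p∧x≢y⇒x∈p-y g∈S (λ { refl → f∉ g∈ }))

  _++ʷ_ : ∀ {S u v w es fs} → UWalk G S u v es → UWalk G S v w fs → UWalk G S u w (es ++ fs)
  nil        ++ʷ q = q
  fwd f∈ t p ++ʷ q = fwd f∈ t (p ++ʷ q)
  bwd f∈ t p ++ʷ q = bwd f∈ t (p ++ʷ q)

  linked-≡ : ∀ {S u v} → u ≡ v → Linked S u v
  linked-≡ refl = _ , nil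

  linked-arc : ∀ {S f} → f ∈ S → Linked S (tail f) (head f)
  linked-arc f∈ = _ , fwd f∈ refl nil

  linked-trans : ∀ {S u v w} → Linked S u v → Linked S v w → Linked S u w
  linked-trans (_ , p) (_ , q) = _ , p ++ʷ q

  walk-reverse : ∀ {S u v es} → UWalk G S u v es → Linked S v u
  walk-reverse nil             = linked-≡ refl
  walk-reverse (fwd f∈ refl w) = linked-trans (walk-reverse w) (_ , bwd f∈ refl nil)
  walk-reverse (bwd f∈ refl w) = linked-trans (walk-reverse w) (linked-arc f∈)

  linked-sym : ∀ {S u v} → Linked S u v → Linked S v u
  linked-sym (_ , w) = walk-reverse w

  linked-mono : ∀ {S S′ u v} → S ⊆ S′ → Linked S u v → Linked S′ u v
  linked-mono S⊆S′ (_ , w) = _ , walk-mono S⊆S′ w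

  trail-suffix : ∀ {S a b es f} → UWalk G S a b es → Unique es → f ∈ˡ es
               → ∃ λ fs → Unique (f ∷ fs) × (UWalk G S (head f) b fs ⊎ UWalk G S (tail f) b fs)
  trail-suffix (fwd _ _ w) es! (here refl) = _ , es! , inj₁ w
  trail-suffix (bwd _ _ w) es! (here refl) = _ , es! , inj₂ w
  trail-suffix (fwd _ _ w) (_ ∷ es!) (there f∈) = trail-suffix w es! f∈
  trail-suffix (bwd _ _ w) (_ ∷ es!) (there f∈) = trail-suffix w es! f∈

  -- A repeated arc is removed by cutting out the closed detour between its two traversals.
  walk⇒trail : ∀ {S u v es} → UWalk G S u v es → ∃ λ fs → UWalk G S u v fs × Unique fs
  walk⇒trail nil = [] , nil , []
  walk⇒trail (fwd {e = f} f∈ refl w) with walk⇒trail w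
  ... | fs , t , fs! with f ∈ˡ? fs
  ...   | no f∉ = f ∷ fs , fwd f∈ refl t , ¬Any⇒All¬ fs f∉ ∷ fs!
  ...   | yes f∈fs with trail-suffix t fs! f∈fs
  ...     | gs , gs! , inj₁ t′ = f ∷ gs , fwd f∈ refl t′ , gs!
  ...     | gs , _ ∷ gs! , inj₂ t′ = gs , t′ , gs!
  walk⇒trail (bwd {e = f} f∈ refl w) with walk⇒trail w
  ... | fs , t , fs! with f ∈ˡ? fs
  ...   | no f∉ = f ∷ fs , bwd f∈ refl t , ¬Any⇒All¬ fs f∉ ∷ fs!
  ...   | yes f∈fs with trail-suffix t fs! f∈fs
  ...     | gs , _ ∷ gs! , inj₁ t′ = gs , t′ , gs!
  ...     | gs , gs! , inj₂ t′ = f ∷ gs , bwd f∈ refl t′ , gs!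

  trail-split : ∀ {S a b es f} → UWalk G S a b es → Unique es → f ∈ˡ es
              → (Linked (S - f) a (tail f) × Linked (S - f) (head f) b)
              ⊎ (Linked (S - f) a (head f) × Linked (S - f) (tail f) b)
  trail-split (fwd _ refl w) es! (here refl) = inj₁ (linked-≡ refl , (_ , walk-avoid (Unique[x∷xs]⇒x∉xs es!) w))
  trail-split (bwd _ refl w) es! (here refl) = inj₂ (linked-≡ refl , (_ , walk-avoid (Unique[x∷xs]⇒x∉xs es!) w))
  trail-split {S} {f = f} (fwd {e = g} g∈ refl w) es!@(_ ∷ rest!) (there f∈) =
    Sum.map (Product.map₁ (linked-trans step)) (Product.map₁ (linked-trans step))
            (trail-split w rest! f∈)
    where
    step : Linked (S - f) (tail g) (head g)
    step = linked-arc (x∈p∧x≢y⇒x∈p-y g∈ (λ { refl → Unique[x∷xs]⇒x∉xs es! f∈ }))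
  trail-split {S} {f = f} (bwd {e = g} g∈ refl w) es!@(_ ∷ rest!) (there f∈) =
    Sum.map (Product.map₁ (linked-trans step)) (Product.map₁ (linked-trans step))
            (trail-split w rest! f∈)
    where
    step : Linked (S - f) (head g) (tail g)
    step = linked-sym (linked-arc (x∈p∧x≢y⇒x∈p-y g∈ (λ { refl → Unique[x∷xs]⇒x∉xs es! f∈ })))

  trail-arc-ends-linked : ∀ {S a b es f} → UWalk G S a b es → Unique es → f ∈ˡ es
                        → Linked (S - f) b a → Linked (S - f) (head f) (tail f)
  trail-arc-ends-linked w es! f∈ b~a with trail-split w es! f∈
  ... | inj₁ (a~t , h~b) = linked-trans h~b (linked-trans b~a a~t)
  ... | inj₂ (a~h , t~b) = linked-sym (linked-trans t~b (linked-trans b~a a~h))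

  acyclic⇒bridge : ∀ {S f} → Acyclic G S → f ∈ S → ¬ Linked (S - f) (head f) (tail f)
  acyclic⇒bridge {S} {f} acyclic f∈ (_ , w) with walk⇒trail w
  ... | fs , t , fs!
    with acyclic (tail f) (f ∷ fs) (fwd f∈ refl (walk-mono (p─q⊆p S _) t)) (¬Any⇒All¬ fs f∉ ∷ fs!)
    where
    f∉ : f ∉ˡ fs
    f∉ f∈fs = x∈p-y⇒x≢y S (arcs⊆ t f∈fs) refl
  ... | ()

  connected⊆acyclic⇒⊇ : ∀ {T T′} → Acyclic G T → Connected G T′ → T′ ⊆ T → T ⊆ T′
  connected⊆acyclic⇒⊇ {T} {T′} acyclic connected T′⊆T {f} f∈T with f ∈? T′
  ... | yes f∈T′ = f∈T′
  ... | no f∉T′ =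
    ⊥-elim (acyclic⇒bridge acyclic f∈T (linked-mono T′⊆T-f (connected (head f) (tail f))))
    where
    T′⊆T-f : T′ ⊆ T - f
    T′⊆T-f g∈ = x∈p∧x≢y⇒x∈p-y (T′⊆T g∈) (λ { refl → f∉T′ g∈ })

  linked-to-an-end : ∀ {S a es f} → UWalk G S a (tail f) es
                   → Linked (S - f) a (tail f) ⊎ Linked (S - f) a (head f)
  linked-to-an-end nil = inj₁ (linked-≡ refl)
  linked-to-an-end {S} {f = f} (fwd {e = g} g∈ refl w) with g ≟ f
  ... | yes refl = inj₁ (linked-≡ refl)
  ... | no g≢f = Sum.map (linked-trans step) (linked-trans step) (linked-to-an-end w)
    where
    step : Linked (S - f) (tail g) (head g)
    step = linked-arc (x∈p∧x≢y⇒x∈p-y g∈ g≢f)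
  linked-to-an-end {S} {f = f} (bwd {e = g} g∈ refl w) with g ≟ f
  ... | yes refl = inj₂ (linked-≡ refl)
  ... | no g≢f = Sum.map (linked-trans step) (linked-trans step) (linked-to-an-end w)
    where
    step : Linked (S - f) (head g) (tail g)
    step = linked-sym (linked-arc (x∈p∧x≢y⇒x∈p-y g∈ g≢f))

  InArc : Subset m → Fin n → Fin m → Set
  InArc S v g = g ∈ S × head g ≡ v

  NoInArc : Subset m → Fin n → Set
  NoInArc S v = ∀ {g} → ¬ InArc S v g

  AtMostOneInArc : Subset m → Set
  AtMostOneInArc S = ∀ {v g h} → InArc S v g → InArc S v h → g ≡ h

  noInArc-⊆ : ∀ {S T v} → S ⊆ T → NoInArc T v → NoInArc S v
  noInArc-⊆ S⊆T none (g∈ , hg) = none (S⊆T g∈ , hg)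

  atMostOneInArc-⊆ : ∀ {S T} → S ⊆ T → AtMostOneInArc T → AtMostOneInArc S
  atMostOneInArc-⊆ S⊆T one (g∈ , hg) (h∈ , hh) = one (S⊆T g∈ , hg) (S⊆T h∈ , hh)

  inDegree≡1⇒ : ∀ {S v} → inDegree G S v ≡ 1
              → ∃ λ g → InArc S v g × (∀ {h} → InArc S v h → h ≡ g)
  inDegree≡1⇒ {S} {v} d with length-filter≡1⇒ (λ e → (e ∈? S) ×-dec (head e ≟ v)) (allFin m) d
  ... | g , g↦v , unique = g , g↦v , unique (∈-allFin _)

  inDegree≡1⇐ : ∀ {S v g} → InArc S v g → (∀ {h} → InArc S v h → h ≡ g) → inDegree G S v ≡ 1
  inDegree≡1⇐ {S} {v} {g} g↦v unique =
    length-filter≡1⇐ (λ e → (e ∈? S) ×-dec (head e ≟ v)) (allFin⁺ m) (∈-allFin g) g↦v (λ _ → unique)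

  exchange : Subset m → Fin m → Fin m → Subset m
  exchange T e e′ = (T - e) ∪ ⁅ e′ ⁆

  module _ {T : Subset m} {e e′ : Fin m} where

    ∈-exchange⁻ : ∀ {f} → f ∈ exchange T e e′ → f ∈ T - e ⊎ f ≡ e′
    ∈-exchange⁻ f∈ = Sum.map₂ (x∈⁅y⁆⇒x≡y e′) (x∈p∪q⁻ (T - e) ⁅ e′ ⁆ f∈)

    ∈-exchange⁺ : T - e ⊆ exchange T e e′
    ∈-exchange⁺ f∈ = x∈p∪q⁺ (inj₁ f∈)

    e′∈exchange : e′ ∈ exchange T e e′
    e′∈exchange = x∈p∪q⁺ (inj₂ (x∈⁅x⁆ e′))

    exchange-e′⊆T-e : exchange T e e′ - e′ ⊆ T - e
    exchange-e′⊆T-e f∈ with ∈-exchange⁻ (p─q⊆p _ _ f∈)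
    ... | inj₁ f∈T-e = f∈T-e
    ... | inj₂ refl = ⊥-elim (x∈p-y⇒x≢y _ f∈ refl)

    exchange-connected : Connected G T → ¬ Linked (T - e) (tail e′) (head e′)
                       → Connected G (exchange T e e′)
    exchange-connected connected separated a b = linked-trans (toTail a) (linked-sym (toTail b))
      where
      end : ∀ a → Linked (T - e) a (tail e) ⊎ Linked (T - e) a (head e)
      end a = linked-to-an-end (proj₂ (connected a (tail e)))
      lift : ∀ {a b} → Linked (T - e) a b → Linked (exchange T e e′) a b
      lift = linked-mono ∈-exchange⁺
      across : Linked (exchange T e e′) (tail e) (head e)
      across with end (tail e′) | end (head e′)
      ... | inj₁ p | inj₁ q = ⊥-elim (separated (linked-trans p (linked-sym q)))
      ... | inj₂ p | inj₂ q = ⊥-elim (separated (linked-trans p (linked-sym q)))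
      ... | inj₁ p | inj₂ q =
        linked-trans (lift (linked-sym p)) (linked-trans (linked-arc e′∈exchange) (lift q))
      ... | inj₂ p | inj₁ q =
        linked-trans (lift (linked-sym q)) (linked-trans (linked-sym (linked-arc e′∈exchange)) (lift p))
      toTail : ∀ a → Linked (exchange T e e′) a (tail e)
      toTail a with end a
      ... | inj₁ p = lift p
      ... | inj₂ p = linked-trans (lift p) (linked-sym across)

    exchange-acyclic : Acyclic G T → ¬ Linked (T - e) (tail e′) (head e′)
                     → Acyclic G (exchange T e e′)
    exchange-acyclic acyclic separated u es c es! with e′ ∈ˡ? es
    ... | no e′∉ = acyclic u es (relabel inT c) es!
      where
      inT : ∀ {f} → f ∈ˡ es → f ∈ exchange T e e′ → f ∈ T
      inT f∈es f∈ with ∈-exchange⁻ f∈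
      ... | inj₁ f∈T-e = p─q⊆p T _ f∈T-e
      ... | inj₂ refl = ⊥-elim (e′∉ f∈es)
    ... | yes e′∈ =
      ⊥-elim (separated (linked-sym (linked-mono exchange-e′⊆T-e
        (trail-arc-ends-linked c es! e′∈ (linked-≡ refl)))))

    exchange-isUndirectedTree : IsUndirectedTree G T → ¬ Linked (T - e) (tail e′) (head e′)
                              → IsUndirectedTree G (exchange T e e′)
    exchange-isUndirectedTree (connected , acyclic) separated =
      exchange-connected connected separated , exchange-acyclic acyclic separated

    inDegree-exchange-head : ∀ {v} → head e′ ≡ v → (∀ {h} → InArc T v h → h ≡ e)
                           → inDegree G (exchange T e e′) v ≡ 1
    inDegree-exchange-head refl onlyE = inDegree≡1⇐ (e′∈exchange , refl) unique
      where
      unique : ∀ {h} → InArc (exchange T e e′) (head e′) h → h ≡ e′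
      unique (h∈ , hh) with ∈-exchange⁻ h∈
      ... | inj₁ h∈T-e = ⊥-elim (x∈p-y⇒x≢y T h∈T-e (onlyE (p─q⊆p T _ h∈T-e , hh)))
      ... | inj₂ h≡e′ = h≡e′

    inDegree-exchange-other : ∀ {v} → v ≢ head e → v ≢ head e′ → inDegree G T v ≡ 1
                            → inDegree G (exchange T e e′) v ≡ 1
    inDegree-exchange-other v≢he v≢he′ d with inDegree≡1⇒ d
    ... | g , (g∈ , refl) , unique =
      inDegree≡1⇐ (∈-exchange⁺ (x∈p∧x≢y⇒x∈p-y g∈ λ { refl → v≢he refl }) , refl) unique′
      where
      unique′ : ∀ {h} → InArc (exchange T e e′) (head g) h → h ≡ g
      unique′ (h∈ , hh) with ∈-exchange⁻ h∈
      ... | inj₁ h∈T-e = unique (p─q⊆p T _ h∈T-e , hh)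
      ... | inj₂ refl = ⊥-elim (v≢he′ (sym hh))

  Step : Subset m → Fin n → Fin n → Set
  Step S u v = ∃ λ g → g ∈ S × tail g ≡ u × head g ≡ v

  DirectedPath : Subset m → Fin n → Fin n → Set
  DirectedPath S = Star (Step S)

  -- Once a trail has entered a vertex through its only in-arc, it can never leave it backwards.
  trail-from-source⇒directed : ∀ {S y x es} → AtMostOneInArc S → NoInArc S y → UWalk G S y x es → Unique es
                             → DirectedPath S y x
  trail-from-source⇒directed {S} one none w es! = directed w es! (λ g↦y _ → none g↦y)
    where
    directed : ∀ {y x es} → UWalk G S y x es → Unique es → (∀ {g} → InArc S y g → g ∉ˡ es)
             → DirectedPath S y x
    directed nil _ _ = ε
    directed (fwd f∈ refl w) es!@(_ ∷ rest!) _ =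
      (_ , f∈ , refl , refl) ◅ directed w rest! λ g↦hf g∈ →
        Unique[x∷xs]⇒x∉xs es! (subst (_∈ˡ _) (one g↦hf (f∈ , refl)) g∈)
    directed (bwd f∈ refl _) _ fresh = ⊥-elim (fresh (f∈ , refl) (here refl))

  directedPath-end : ∀ {S u v} → DirectedPath S u v → u ≡ v ⊎ ∃ (InArc S v)
  directedPath-end ε = inj₁ refl
  directedPath-end ((g , g∈ , _ , refl) ◅ p) with directedPath-end p
  ... | inj₁ refl = inj₂ (g , g∈ , refl)
  ... | inj₂ entered = inj₂ entered

  directedPath-leaves : ∀ {T T′ a u g} → DirectedPath T′ u (tail g) → g ∈ T′ → g ∉ T
                      → Linked (T ∩ T′) a u
                      → ∃ λ e′ → e′ ∈ T′ × e′ ∉ T × Linked (T ∩ T′) a (tail e′)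
  directedPath-leaves {g = g} ε g∈T′ g∉T a~u = g , g∈T′ , g∉T , a~u
  directedPath-leaves {T} ((f , f∈T′ , refl , refl) ◅ p) g∈T′ g∉T a~u with f ∈? T
  ... | no f∉T = f , f∈T′ , f∉T , a~u
  ... | yes f∈T =
    directedPath-leaves p g∈T′ g∉T (linked-trans a~u (linked-arc (x∈p∩q⁺ (f∈T , f∈T′))))

  acyclic⇒¬everyVertexEntered : ∀ {S} → Acyclic G S → Fin n → ¬ (∀ v → ∃ (InArc S v))
  acyclic⇒¬everyVertexEntered {S} acyclic x₀ entered =
    climb (suc n) x₀ [] ⊤ (s≤s (∣p∣≤n ⊤)) (λ ()) (λ _ _ → ∈⊤) (λ ())
    where
    -- Climb from x₀ against in-arcs.  Every vertex already left (listed in V) reaches the current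
    -- vertex x by a walk of arcs entering V; since x ∉ V this walk avoids the in-arc of x, so the
    -- climb can never revisit a vertex.  U contains the unvisited vertices and bounds the climb.
    climb : ∀ k x V (U : Subset n) → ∣ U ∣ < k → x ∉ˡ V → (∀ y → y ∉ˡ x ∷ V → y ∈ U)
          → (∀ {y} → y ∈ˡ V → ∃ λ es → UWalk G S y x es × All (λ f → head f ∈ˡ V) es) → ⊥
    climb (suc k) x V U (s≤s U<k) x∉V unvisited descend with entered x
    ... | g , g∈ , refl with DecMembership._∈?_ _≟_ (tail g) (head g ∷ V)
    ...   | yes (here tg≡hg) = acyclic⇒bridge acyclic g∈ (linked-≡ (sym tg≡hg))
    ...   | yes (there tg∈V) =
      let (es , w , heads) = descend tg∈V
      in acyclic⇒bridge acyclic g∈ (walk-reverse (walk-avoid (λ g∈es → x∉V (All.lookup heads g∈es)) w))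
    ...   | no tg∉ = climb k (tail g) (head g ∷ V) (U - tail g)
                       (<-≤-trans (x∈p⇒∣p-x∣<∣p∣ (unvisited _ tg∉)) U<k) tg∉ unvisited′ descend′
      where
      unvisited′ : ∀ y → y ∉ˡ tail g ∷ head g ∷ V → y ∈ U - tail g
      unvisited′ y y∉ = x∈p∧x≢y⇒x∈p-y (unvisited y (λ y∈ → y∉ (there y∈))) (λ y≡ → y∉ (here y≡))
      step : UWalk G S (head g) (tail g) (g ∷ [])
      step = bwd g∈ refl nil
      descend′ : ∀ {y} → y ∈ˡ head g ∷ V
               → ∃ λ es → UWalk G S y (tail g) es × All (λ f → head f ∈ˡ head g ∷ V) es
      descend′ (here refl) = _ , step , here refl ∷ []
      descend′ (there y∈V) =
        let (es , w , heads) = descend y∈V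
        in _ , w ++ʷ step , Allₚ.++⁺ (All.map there heads) (here refl ∷ [])

  module DirectedSpanningTree {T} (t : IsDirectedSpanningTree G T) where

    connected : Connected G T
    connected = proj₁ (proj₁ t)

    acyclic : Acyclic G T
    acyclic = proj₂ (proj₁ t)

    root : Fin n
    root = proj₁ (proj₂ t)

    inDegree≡1 : ∀ {v} → v ≢ root → inDegree G T v ≡ 1
    inDegree≡1 = proj₂ (proj₂ t) _

    parent : ∀ {v} → v ≢ root → ∃ λ g → InArc T v g × (∀ {h} → InArc T v h → h ≡ g)
    parent v≢r = inDegree≡1⇒ (inDegree≡1 v≢r)

    root-unentered : NoInArc T root
    root-unentered {f} f↦r = acyclic⇒¬everyVertexEntered acyclic root entered
      where
      entered : ∀ v → ∃ (InArc T v)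
      entered v with v ≟ root
      ... | yes refl = f , f↦r
      ... | no v≢r = let (g , g↦v , _) = parent v≢r in g , g↦v

    atMostOneInArc : AtMostOneInArc T
    atMostOneInArc {v} g↦v h↦v with v ≟ root
    ... | yes refl = ⊥-elim (root-unentered g↦v)
    ... | no v≢r = let (_ , _ , unique) = parent v≢r in trans (unique g↦v) (sym (unique h↦v))

    trail-from-root : ∀ v → ∃ λ es → UWalk G T root v es × Unique es
    trail-from-root v = walk⇒trail (proj₂ (connected root v))

    directedPath-from-root : ∀ v → DirectedPath T root v
    directedPath-from-root v =
      let (_ , w , es!) = trail-from-root v in trail-from-source⇒directed atMostOneInArc root-unentered w es!

    cutting-parent-separates-root : ∀ {e} → e ∈ T → ¬ Linked (T - e) root (head e)
    cutting-parent-separates-root {e} e∈T (_ , w) with walk⇒trail w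
    ... | _ , t , es! with directedPath-end (trail-from-source⇒directed one none t es!)
      where
      one : AtMostOneInArc (T - e)
      one = atMostOneInArc-⊆ (p─q⊆p T _) atMostOneInArc
      none : NoInArc (T - e) root
      none = noInArc-⊆ (p─q⊆p T _) root-unentered
    ... | inj₁ r≡he = root-unentered (e∈T , sym r≡he)
    ... | inj₂ (h , h∈ , hh) = x∈p-y⇒x≢y T h∈ (atMostOneInArc (p─q⊆p T _ h∈ , hh) (e∈T , refl))

  ExchangePair : Subset m → Subset m → Set
  ExchangePair T T′ = Σ (Fin m) λ e → Σ (Fin m) λ e′
    → e ∈ T × e ∉ T′ × e′ ∈ T′ × e′ ∉ T × IsDirectedSpanningTree G (exchange T e e′)

  module _ {T T′} (t : IsDirectedSpanningTree G T) (t′ : IsDirectedSpanningTree G T′) where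
    private
      module A = DirectedSpanningTree t
      module B = DirectedSpanningTree t′

    exchange-intoRoot : ∀ {e e′ qs} → InArc T′ A.root e′ → UWalk G T A.root (tail e′) qs → Unique qs
                      → e ∈ˡ qs → e ∉ T′ → ExchangePair T T′
    exchange-intoRoot {e} {e′} (e′∈T′ , he′) q qs! e∈qs e∉T′ =
      e , e′ , e∈T , e∉T′ , e′∈T′ , e′∉T ,
      exchange-isUndirectedTree (proj₁ t) separated , head e , inDegrees
      where
      e∈T : e ∈ T
      e∈T = arcs⊆ q e∈qs
      e′∉T : e′ ∉ T
      e′∉T e′∈T = A.root-unentered (e′∈T , he′)
      separated : ¬ Linked (T - e) (tail e′) (head e′)
      separated t~h = acyclic⇒bridge A.acyclic e∈T
        (trail-arc-ends-linked q qs! e∈qs (subst (Linked (T - e) (tail e′)) he′ t~h))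
      inDegrees : ∀ v → v ≢ head e → inDegree G (exchange T e e′) v ≡ 1
      inDegrees v v≢he with v ≟ A.root
      ... | yes refl = inDegree-exchange-head he′ (λ h↦r → ⊥-elim (A.root-unentered h↦r))
      ... | no v≢r = inDegree-exchange-other v≢he (λ v≡he′ → v≢r (trans v≡he′ he′)) (A.inDegree≡1 v≢r)

    exchange-distinctRoots : A.root ≢ B.root → ExchangePair T T′
    exchange-distinctRoots r≢r′ with B.parent r≢r′
    ... | e′ , (e′∈T′ , he′) , _ with A.trail-from-root (tail e′)
    ... | qs , q , qs! with all? (_∈? T′) qs
    ... | no qs⊈T′ = let (e , e∈qs , e∉T′) = find (¬All⇒Any¬ (_∈? T′) qs qs⊈T′)
                     in exchange-intoRoot (e′∈T′ , he′) q qs! e∈qs e∉T′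
    ... | yes qs⊆T′ = ⊥-elim (acyclic⇒bridge B.acyclic e′∈T′
                        (subst (λ x → Linked (T′ - e′) x (tail e′)) (sym he′) (_ , relabel inT′-e′ q)))
      where
      inT′-e′ : ∀ {f} → f ∈ˡ qs → f ∈ T → f ∈ T′ - e′
      inT′-e′ f∈qs f∈T = x∈p∧x≢y⇒x∈p-y (All.lookup qs⊆T′ f∈qs) λ { refl → A.root-unentered (f∈T , he′) }

    exchange-belowRoot : ∀ {e′} → A.root ≡ B.root → e′ ∈ T′ → e′ ∉ T → Linked (T ∩ T′) A.root (tail e′)
                       → ExchangePair T T′
    exchange-belowRoot {e′} r≡r′ e′∈T′ e′∉T r~te′
      with A.parent (λ he′≡r → B.root-unentered (e′∈T′ , trans he′≡r r≡r′))
    ... | e , (e∈T , he) , _ =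
      e , e′ , e∈T , e∉T′ , e′∈T′ , e′∉T ,
      exchange-isUndirectedTree (proj₁ t) separated , A.root , inDegrees
      where
      e∉T′ : e ∉ T′
      e∉T′ e∈T′ = e′∉T (subst (_∈ T) (B.atMostOneInArc (e∈T′ , he) (e′∈T′ , refl)) e∈T)
      T∩T′⊆T-e : T ∩ T′ ⊆ T - e
      T∩T′⊆T-e f∈ = let (f∈T , f∈T′) = x∈p∩q⁻ T T′ f∈ in x∈p∧x≢y⇒x∈p-y f∈T λ { refl → e∉T′ f∈T′ }
      separated : ¬ Linked (T - e) (tail e′) (head e′)
      separated t~h = A.cutting-parent-separates-root e∈T
        (subst (Linked (T - e) A.root) (sym he) (linked-trans (linked-mono T∩T′⊆T-e r~te′) t~h))
      inDegrees : ∀ v → v ≢ A.root → inDegree G (exchange T e e′) v ≡ 1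
      inDegrees v v≢r with v ≟ head e′
      ... | yes refl = inDegree-exchange-head refl (λ h↦v → A.atMostOneInArc h↦v (e∈T , he))
      ... | no v≢he′ = inDegree-exchange-other (λ v≡he → v≢he′ (trans v≡he he)) v≢he′ (A.inDegree≡1 v≢r)

    exchange-sameRoot : A.root ≡ B.root → T ≢ T′ → ExchangePair T T′
    exchange-sameRoot r≡r′ T≢T′
      with ⊈⇒∃ (λ T′⊆T → T≢T′ (⊆-antisym (connected⊆acyclic⇒⊇ A.acyclic B.connected T′⊆T) T′⊆T))
    ... | g , g∈T′ , g∉T
      with directedPath-leaves (B.directedPath-from-root (tail g)) g∈T′ g∉T (linked-≡ r≡r′)
    ... | e′ , e′∈T′ , e′∉T , r~te′ = exchange-belowRoot r≡r′ e′∈T′ e′∉T r~te′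

theorem3 : (G : DiGraph) → (T T′ : Subset (DiGraph.m G))
    → IsDirectedSpanningTree G T → IsDirectedSpanningTree G T′ → T ≢ T′
    → Σ (Fin (DiGraph.m G)) λ e → Σ (Fin (DiGraph.m G)) λ e′
    → e ∈ T × e ∉ T′ × e′ ∈ T′ × e′ ∉ T
    × IsDirectedSpanningTree G ((T - e) ∪ ⁅ e′ ⁆)
theorem3 G T T′ t t′ T≢T′ with DirectedSpanningTree.root G t ≟ DirectedSpanningTree.root G t′
... | yes r≡r′ = exchange-sameRoot G t t′ r≡r′ T≢T′
... | no r≢r′ = exchange-distinctRoots G t t′ r≢r′
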